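{- Let $H$ be a finite simple graph with at least one edge and no isolated vertices, and let $t \geq 1$. Let $C$ be the graph obtained from a copy of the generalized Mycielskian $\mu_t(H)$ (with root $w$) by adding $\ell \geq 1$ new pendant vertices $x_1, x_2, \dots, x_\ell$, each adjacent only to $w$. If $S$ is a minimum size subset of $V(\mu_t(H)) \setminus \{w\}$ such that $S \cup \{w\}$ is a determining set for $\mu_t(H)$, then $S \cup \{x_2, \dots, x_\ell\}$ is a minimum size determining set for $C$.
   Context: For a finite simple graph $G$ with $V(G)=\{v_1,\dots,v_n\}$ and $t\ge 1$, the generalized Mycielskian $\mu_t(G)$ has vertex set $\{u_i^s : 1\le i\le n,\ 0\le s\le t\}\cup\{w\}$, where $u_i^0=v_i$ (original vertices), $u_i^s$ for $s\ge1$ are shadow vertices at level $s$, and $w$ is the root. For each edge $v_iv_j$ of $G$, $\mu_t(G)$ has the edge $u_i^0u_j^0$ and the edges $u_i^su_j^{s+1}$ and $u_j^su_i^{s+1}$ for $0\le s<t$; in addition $u_i^t w$ is an edge for every $1\le i\le n$. There are no other edges. A subset $S\subseteq V(G)$ is a determining set for $G$ if the only automorphism of $G$ fixing every vertex of $S$ is the identity; $\det(G)$ is the minimum size of a determining set. -}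

module Defs where

open import Data.Nat using (ℕ; zero; suc; _≤_)
open import Data.Fin using (Fin; toℕ)
open import Data.Sum using (_⊎_; inj₁; inj₂)
open import Data.Product using (_×_; ∃; ∃-syntax)
open import Data.Unit using (⊤)
open import Data.Empty using (⊥)
open import Data.List using (List; length; map; _++_; drop; _∷_)
open import Data.List.Relation.Unary.Unique.Propositional using (Unique)
open import Data.List.Membership.Propositional using (_∈_; _∉_)
open import Data.List.Relation.Unary.All using (All)
open import Function.Bundles using (_↔_; Inverse)
open import Relation.Binary.PropositionalEquality using (_≡_)
open import Relation.Nullary using (¬_; Dec)

Rel : Set → Set₁
Rel V = V → V → Set

record IsSimple {n : ℕ} (E : Rel (Fin n)) : Set where
  field
    sym    : ∀ i j → E i j → E j i
    irrefl : ∀ i → ¬ E i i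
    dec    : ∀ i j → Dec (E i j)

HasEdge : {n : ℕ} → Rel (Fin n) → Set
HasEdge E = ∃[ i ] ∃[ j ] E i j

NoIsolated : {n : ℕ} → Rel (Fin n) → Set
NoIsolated E = ∀ i → ∃[ j ] E i j

IsAut : {V : Set} → Rel V → V ↔ V → Set
IsAut {V} R π = ∀ (x y : V) → (R x y → R (to x) (to y)) × (R (to x) (to y) → R x y)
  where open Inverse π

Determining : {V : Set} → Rel V → List V → Set
Determining {V} R S =
  ∀ (π : V ↔ V) → IsAut R π → (∀ x → x ∈ S → Inverse.to π x ≡ x) → ∀ x → Inverse.to π x ≡ x

IsMinDet : {V : Set} → Rel V → List V → Set
IsMinDet {V} R S =
  Unique S × Determining R S ×
  (∀ (T : List V) → Unique T → Determining R T → length S ≤ length T)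

-- Vertices of the generalized Mycielskian μ_t(G), G on Fin n:
-- u i s = u_i^s (s = 0 original, 1..t shadow levels), root = w.
data MV (n t : ℕ) : Set where
  u    : Fin n → Fin (suc t) → MV n t
  root : MV n t

MAdj : {n : ℕ} (t : ℕ) → Rel (Fin n) → Rel (MV n t)
MAdj t E (u i s) (u j s') =
  E i j × ((toℕ s ≡ 0 × toℕ s' ≡ 0) ⊎ (suc (toℕ s) ≡ toℕ s') ⊎ (toℕ s ≡ suc (toℕ s')))
MAdj t E (u i s) root = toℕ s ≡ t
MAdj t E root (u j s') = toℕ s' ≡ t
MAdj t E root root = ⊥

-- The graph C: μ_t(G) plus ℓ pendant vertices (inj₂ k = x_{k+1}) attached to w.
CAdj : {n : ℕ} (t ℓ : ℕ) → Rel (Fin n) → Rel (MV n t ⊎ Fin ℓ)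
CAdj t ℓ E (inj₁ a) (inj₁ b) = MAdj t E a b
CAdj t ℓ E (inj₁ root) (inj₂ _) = ⊤
CAdj t ℓ E (inj₁ (u _ _)) (inj₂ _) = ⊥
CAdj t ℓ E (inj₂ _) (inj₁ root) = ⊤
CAdj t ℓ E (inj₂ _) (inj₁ (u _ _)) = ⊥
CAdj t ℓ E (inj₂ _) (inj₂ _) = ⊥

IsMinRootDet : {n : ℕ} (t : ℕ) → Rel (Fin n) → List (MV n t) → Set
IsMinRootDet {n} t E S =
  Unique S × root ∉ S × Determining (MAdj t E) (root ∷ S) ×
  (∀ (T : List (MV n t)) → Unique T → root ∉ T → Determining (MAdj t E) (root ∷ T) →
     length S ≤ length T)

-- Pendant vertices are the only vertices of C without two distinct neighbours: an inner
-- vertex u_i^s has neighbours on levels ≤ s and s + 1 (the root counting as level t + 1), and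
-- the root has the level-t shadows of both ends of an edge. Hence every automorphism of C
-- permutes the pendants, fixes w, and restricts to an automorphism of μ_t(H) fixing w;
-- conversely such automorphisms extend by the identity on the pendants. Fixing x₂, …, x_ℓ
-- then fixes x₁ as well. For minimality, a determining set of C misses at most one pendant
-- (two missing ones could be swapped), and its inner non-root vertices together with w
-- determine μ_t(H).

module Submission where

open import Defs
open import Data.Nat using (ℕ; zero; suc; _+_; _≤_; z≤n; s≤s)
open import Data.Nat.Properties using (≤-trans; ≤-reflexive; +-mono-≤; n≤1+n; 1+n≰n; module ≤-Reasoning)
  renaming (_≟_ to _≟ℕ_)
open import Data.Fin using (Fin; zero; suc; toℕ; fromℕ; inject₁; lower₁; punchIn)
open import Data.Fin.Properties
  using (toℕ-fromℕ; toℕ-inject₁; toℕ-lower₁; 0≢1+n; punchInᵢ≢i; punchIn-injective; all?; ¬∀⟶∃¬)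
  renaming (_≟_ to _≟F_)
import Data.Fin.Permutation.Components as PC
open import Data.Fin.Permutation using (transpose)
open import Data.Sum using (_⊎_; inj₁; inj₂; [_,_]′)
open import Data.Sum.Properties using (inj₁-injective; inj₂-injective; ≡-dec)
open import Data.Sum.Function.Propositional using (_⊎-↔_)
open import Data.Product using (_×_; _,_; proj₁; proj₂; ∃-syntax)
open import Data.Unit using (tt)
open import Data.Empty using (⊥-elim)
open import Data.List using (List; []; _∷_; map; _++_; drop; allFin; length; filter)
open import Data.List.Properties using (length-++; length-map; length-tabulate; filter-notAll)
open import Data.List.Relation.Unary.Any using (here; there)
import Data.List.Relation.Unary.Any as Any
import Data.List.Relation.Unary.All as All
open import Data.List.Relation.Unary.AllPairs using ([]; _∷_)
open import Data.List.Relation.Unary.Unique.Propositional using (Unique)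
import Data.List.Relation.Unary.Unique.Propositional.Properties as Unique
open import Data.List.Relation.Binary.Subset.Propositional using (_⊆_)
open import Data.List.Membership.Propositional using (_∈_; _∉_)
open import Data.List.Membership.Propositional.Properties
  using (∈-map⁺; ∈-map⁻; ∈-++⁺ˡ; ∈-++⁺ʳ; ∈-++⁻; ∈-tabulate⁺; ∈-filter⁺; ∈-filter⁻)
import Data.List.Membership.DecPropositional as DecMembership
open import Function using (_∘_)
open import Function.Bundles using (_↔_; Inverse; mk↔ₛ′; Injection)
open import Function.Construct.Identity using (↔-id)
open import Function.Construct.Symmetry using (↔-sym)
open import Function.Properties.Inverse using (↔⇒↣)
open import Relation.Binary.Definitions using (DecidableEquality)
open import Relation.Binary.PropositionalEquality
open import Relation.Nullary using (¬_; Dec; yes; no; ¬?; contradiction)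
open import Relation.Unary using (Decidable)

module _ {A : Set} (_≟_ : DecidableEquality A) where

  Unique-⊆⇒length≤ : {xs ys : List A} → Unique xs → xs ⊆ ys → length xs ≤ length ys
  Unique-⊆⇒length≤ {[]} _ _ = z≤n
  Unique-⊆⇒length≤ {x ∷ xs} {ys} (x∉xs ∷ xs!) x∷xs⊆ys =
    ≤-trans (s≤s (Unique-⊆⇒length≤ xs! xs⊆ys∖x))
            (filter-notAll x≢? ys (Any.map (λ x≡y x≢y → x≢y x≡y) (x∷xs⊆ys (here refl))))
    where
    x≢? : ∀ y → Dec (x ≢ y)
    x≢? y = ¬? (x ≟ y)
    xs⊆ys∖x : xs ⊆ filter x≢? ys
    xs⊆ys∖x z∈xs = ∈-filter⁺ x≢? (x∷xs⊆ys (there z∈xs)) (All.lookup x∉xs z∈xs)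

module _ {A B : Set} where

  map-inj₁-++-map-inj₂-Unique : {xs : List A} {ys : List B} → Unique xs → Unique ys →
                                Unique (map inj₁ xs ++ map inj₂ ys)
  map-inj₁-++-map-inj₂-Unique xs! ys! =
    Unique.++⁺ (Unique.map⁺ inj₁-injective xs!) (Unique.map⁺ inj₂-injective ys!) disjoint
    where
    disjoint : ∀ {v} → ¬ (v ∈ map inj₁ _ × v ∈ map inj₂ _)
    disjoint (p , q) with ∈-map⁻ inj₁ p | ∈-map⁻ inj₂ q
    ... | _ , _ , refl | _ , _ , ()

  Unique-⊎-⊆⇒length≤ : DecidableEquality (A ⊎ B) → {xs : List A} {ys : List B} {zs : List (A ⊎ B)} →
                        Unique xs → Unique ys → map inj₁ xs ⊆ zs → map inj₂ ys ⊆ zs →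
                        length xs + length ys ≤ length zs
  Unique-⊎-⊆⇒length≤ _≟_ {xs} {ys} {zs} xs! ys! xs⊆zs ys⊆zs = begin
    length xs + length ys                        ≡⟨ sym (cong₂ _+_ (length-map inj₁ xs) (length-map inj₂ ys)) ⟩
    length (map inj₁ xs) + length (map inj₂ ys)  ≡⟨ sym (length-++ (map inj₁ xs)) ⟩
    length (map inj₁ xs ++ map inj₂ ys)          ≤⟨ Unique-⊆⇒length≤ _≟_ (map-inj₁-++-map-inj₂-Unique xs! ys!) ⊆zs ⟩
    length zs                                    ∎
    where
    open ≤-Reasoning
    ⊆zs : map inj₁ xs ++ map inj₂ ys ⊆ zs
    ⊆zs p = [ xs⊆zs , ys⊆zs ]′ (∈-++⁻ (map inj₁ xs) p)

  lefts : List (A ⊎ B) → List A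
  lefts []             = []
  lefts (inj₁ a ∷ xs)  = a ∷ lefts xs
  lefts (inj₂ _ ∷ xs)  = lefts xs

  ∈-lefts⁺ : ∀ {a xs} → inj₁ a ∈ xs → a ∈ lefts xs
  ∈-lefts⁺ {xs = inj₁ _ ∷ _} (here refl) = here refl
  ∈-lefts⁺ {xs = inj₁ _ ∷ _} (there p)   = there (∈-lefts⁺ p)
  ∈-lefts⁺ {xs = inj₂ _ ∷ _} (there p)   = ∈-lefts⁺ p

  ∈-lefts⁻ : ∀ {a} xs → a ∈ lefts xs → inj₁ a ∈ xs
  ∈-lefts⁻ (inj₁ _ ∷ _)  (here refl) = here refl
  ∈-lefts⁻ (inj₁ _ ∷ xs) (there p)   = there (∈-lefts⁻ xs p)
  ∈-lefts⁻ (inj₂ _ ∷ xs) p           = there (∈-lefts⁻ xs p)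

  lefts-Unique : ∀ {xs} → Unique xs → Unique (lefts xs)
  lefts-Unique {[]}          _           = []
  lefts-Unique {inj₁ a ∷ xs} (a∉ ∷ xs!) =
    All.tabulate (λ b∈ a≡b → All.lookup a∉ (∈-lefts⁻ xs b∈) (cong inj₁ a≡b)) ∷ lefts-Unique xs!
  lefts-Unique {inj₂ _ ∷ _}  (_ ∷ xs!)  = lefts-Unique xs!

  restrict₁ : (π : (A ⊎ B) ↔ (A ⊎ B)) →
              (∀ a → ∃[ b ] Inverse.to π (inj₁ a) ≡ inj₁ b) →
              (∀ a → ∃[ b ] Inverse.from π (inj₁ a) ≡ inj₁ b) → A ↔ A
  restrict₁ π to₁ from₁ = mk↔ₛ′ (proj₁ ∘ to₁) (proj₁ ∘ from₁) to∘from from∘to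
    where
    open Inverse π
    to∘from : ∀ a → proj₁ (to₁ (proj₁ (from₁ a))) ≡ a
    to∘from a = inj₁-injective (begin
      inj₁ (proj₁ (to₁ (proj₁ (from₁ a))))  ≡⟨ sym (proj₂ (to₁ _)) ⟩
      to (inj₁ (proj₁ (from₁ a)))           ≡⟨ cong to (sym (proj₂ (from₁ a))) ⟩
      to (from (inj₁ a))                    ≡⟨ strictlyInverseˡ (inj₁ a) ⟩
      inj₁ a                                ∎)
      where open ≡-Reasoning
    from∘to : ∀ a → proj₁ (from₁ (proj₁ (to₁ a))) ≡ a
    from∘to a = inj₁-injective (begin
      inj₁ (proj₁ (from₁ (proj₁ (to₁ a))))  ≡⟨ sym (proj₂ (from₁ _)) ⟩
      from (inj₁ (proj₁ (to₁ a)))           ≡⟨ cong from (sym (proj₂ (to₁ a))) ⟩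
      from (to (inj₁ a))                    ≡⟨ strictlyInverseʳ (inj₁ a) ⟩
      inj₁ a                                ∎)
      where open ≡-Reasoning

allButOne-witnesses : ∀ {m} {P : Fin (suc m) → Set} → Decidable P →
                      (∀ {a b} → ¬ P a → ¬ P b → a ≡ b) →
                      ∃[ ks ] Unique ks × (∀ {k} → k ∈ ks → P k) × m ≤ length ks
allButOne-witnesses {m} {P} P? ¬P-unique with all? P?
... | yes ∀P = allFin (suc m) , Unique.allFin⁺ (suc m) , (λ {k} _ → ∀P k) ,
               ≤-trans (n≤1+n m) (≤-reflexive (sym (length-tabulate (λ k → k))))
... | no ¬∀P with ¬∀⟶∃¬ (suc m) P P? ¬∀P
...   | a , ¬Pa = map (punchIn a) (allFin m) ,
                  Unique.map⁺ (punchIn-injective a _ _) (Unique.allFin⁺ m) ,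
                  P-punchIn ,
                  ≤-reflexive (sym (trans (length-map (punchIn a) (allFin m)) (length-tabulate (λ k → k))))
  where
  P-punchIn : ∀ {k} → k ∈ map (punchIn a) (allFin m) → P k
  P-punchIn k∈ with ∈-map⁻ (punchIn a) k∈
  ... | j , _ , refl with P? (punchIn a j)
  ...   | yes Pk = Pk
  ...   | no ¬Pk = contradiction (sym (¬P-unique ¬Pa ¬Pk)) (punchInᵢ≢i a j)

transpose-matchˡ : ∀ {n} (i j : Fin n) → PC.transpose i j i ≡ j
transpose-matchˡ i j with i ≟F i
... | yes _   = refl
... | no i≢i = contradiction refl i≢i

transpose-other : ∀ {n} {i j k : Fin n} → k ≢ i → k ≢ j → PC.transpose i j k ≡ k
transpose-other {i = i} {j} {k} k≢i k≢j with k ≟F i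
... | yes k≡i = contradiction k≡i k≢i
... | no _ with k ≟F j
...   | yes k≡j = contradiction k≡j k≢j
...   | no _    = refl

TwoNeighbours : {V : Set} → Rel V → V → Set
TwoNeighbours R v = ∃[ a ] ∃[ b ] R v a × R v b × a ≢ b

module _ {V : Set} {R : Rel V} {π : V ↔ V} (aut : IsAut R π) where
  open Inverse π

  IsAut-inverse : IsAut R (↔-sym π)
  IsAut-inverse x y =
    (λ r → proj₂ (aut (from x) (from y)) (subst₂ R (sym (strictlyInverseˡ x)) (sym (strictlyInverseˡ y)) r)) ,
    (λ r → subst₂ R (strictlyInverseˡ x) (strictlyInverseˡ y) (proj₁ (aut (from x) (from y)) r))

  IsAut-TwoNeighbours : ∀ {v} → TwoNeighbours R v → TwoNeighbours R (to v)
  IsAut-TwoNeighbours {v} (a , b , va , vb , a≢b) =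
    to a , to b , proj₁ (aut v a) va , proj₁ (aut v b) vb , a≢b ∘ Injection.injective (↔⇒↣ π)

module _ {n t : ℕ} where

  _≟ᴹ_ : DecidableEquality (MV n t)
  u i s ≟ᴹ u j s' with i ≟F j | s ≟F s'
  ... | yes refl | yes refl = yes refl
  ... | no i≢j   | _        = no λ { refl → i≢j refl }
  ... | yes _    | no s≢s'  = no λ { refl → s≢s' refl }
  u _ _ ≟ᴹ root  = no λ ()
  root  ≟ᴹ u _ _ = no λ ()
  root  ≟ᴹ root  = yes refl

  level : MV n t → ℕ
  level (u _ s) = toℕ s
  level root    = suc t

module _ {n t : ℕ} {E : Rel (Fin n)} (noIsolated : NoIsolated E) where

  upper-neighbour : ∀ i s → ∃[ b ] MAdj t E (u i s) b × level b ≡ suc (toℕ s)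
  upper-neighbour i s with toℕ s ≟ℕ t | noIsolated i
  ... | yes s≡t | _       = root , s≡t , cong suc (sym s≡t)
  ... | no s≢t  | j , eij =
    u j (suc (lower₁ s (s≢t ∘ sym))) , (eij , inj₂ (inj₁ (cong suc (sym lowered)))) , cong suc lowered
    where
    lowered : toℕ (lower₁ s (s≢t ∘ sym)) ≡ toℕ s
    lowered = toℕ-lower₁ s (s≢t ∘ sym)

  lower-neighbour : ∀ i s → ∃[ b ] MAdj t E (u i s) b × level b ≤ toℕ s
  lower-neighbour i zero with noIsolated i
  ... | j , eij = u j zero , (eij , inj₁ (refl , refl)) , z≤n
  lower-neighbour i (suc s) with noIsolated i
  ... | j , eij = u j (inject₁ s) , (eij , inj₂ (inj₂ (cong suc (sym (toℕ-inject₁ s))))) ,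
                  ≤-trans (≤-reflexive (toℕ-inject₁ s)) (n≤1+n (toℕ s))

  MAdj-TwoNeighbours : IsSimple E → HasEdge E → ∀ a → TwoNeighbours (MAdj t E) a
  MAdj-TwoNeighbours _ _ (u i s) with lower-neighbour i s | upper-neighbour i s
  ... | b , ib , b≤s | c , ic , c≡1+s =
    b , c , ib , ic , λ b≡c → 1+n≰n (subst (_≤ toℕ s) (trans (cong level b≡c) c≡1+s) b≤s)
  MAdj-TwoNeighbours simple (i , j , eij) root =
    u i (fromℕ t) , u j (fromℕ t) , toℕ-fromℕ t , toℕ-fromℕ t ,
    λ { refl → IsSimple.irrefl simple i eij }

module PendantExtension {n t m : ℕ} (E : Rel (Fin n)) where

  Vertex : Set
  Vertex = MV n t ⊎ Fin (suc m)

  C : Rel Vertex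
  C = CAdj t (suc m) E

  _≟_ : DecidableEquality Vertex
  _≟_ = ≡-dec _≟ᴹ_ _≟F_

  open DecMembership _≟_ using (_∈?_)

  withPendants : List (MV n t) → List Vertex
  withPendants S = map inj₁ S ++ map inj₂ (drop 1 (allFin (suc m)))

  nonRoot? : (a : MV n t) → Dec (a ≢ root)
  nonRoot? a = ¬? (a ≟ᴹ root)

  innerVertices : List Vertex → List (MV n t)
  innerVertices T = filter nonRoot? (lefts T)

  pendant-neighbour : ∀ {k z} → C (inj₂ k) z → z ≡ inj₁ root
  pendant-neighbour {z = inj₁ root} _ = refl

  pendant-¬TwoNeighbours : ∀ k → ¬ TwoNeighbours C (inj₂ k)
  pendant-¬TwoNeighbours k (a , b , ka , kb , a≢b) =
    a≢b (trans (pendant-neighbour ka) (sym (pendant-neighbour kb)))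

  module _ (inner-TwoNeighbours : ∀ a → TwoNeighbours (MAdj t E) a) where

    IsAut-inj₁ : ∀ π → IsAut C π → ∀ a → ∃[ b ] Inverse.to π (inj₁ a) ≡ inj₁ b
    IsAut-inj₁ π aut a with Inverse.to π (inj₁ a) in eq
    ... | inj₁ b = b , refl
    ... | inj₂ k = ⊥-elim (pendant-¬TwoNeighbours k
                    (subst (TwoNeighbours C) eq (IsAut-TwoNeighbours {π = π} aut inj₁-TwoNeighbours)))
      where
      inj₁-TwoNeighbours : TwoNeighbours C (inj₁ a)
      inj₁-TwoNeighbours with inner-TwoNeighbours a
      ... | b , c , ab , ac , b≢c = inj₁ b , inj₁ c , ab , ac , b≢c ∘ inj₁-injective

    module Automorphism (π : Vertex ↔ Vertex) (aut : IsAut C π) where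
      open Inverse π

      IsAut-inj₂ : ∀ k → ∃[ k' ] to (inj₂ k) ≡ inj₂ k'
      IsAut-inj₂ k with to (inj₂ k) in eq
      ... | inj₂ k' = k' , refl
      ... | inj₁ b with IsAut-inj₁ (↔-sym π) (IsAut-inverse {π = π} aut) b
      ...   | c , from-b≡c = contradiction (trans (sym from-b≡k) from-b≡c) λ ()
        where
        from-b≡k : from (inj₁ b) ≡ inj₂ k
        from-b≡k = trans (cong from (sym eq)) (strictlyInverseʳ (inj₂ k))

      IsAut-root : to (inj₁ root) ≡ inj₁ root
      IsAut-root with IsAut-inj₂ zero
      ... | k , eq =
        pendant-neighbour (subst (λ z → C z (to (inj₁ root))) eq (proj₁ (aut (inj₂ zero) (inj₁ root)) tt))

      restriction : MV n t ↔ MV n t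
      restriction = restrict₁ π (IsAut-inj₁ π aut) (IsAut-inj₁ (↔-sym π) (IsAut-inverse {π = π} aut))

      to-restriction : ∀ a → inj₁ (Inverse.to restriction a) ≡ to (inj₁ a)
      to-restriction a = sym (proj₂ (IsAut-inj₁ π aut a))

      restriction-IsAut : IsAut (MAdj t E) restriction
      restriction-IsAut a b =
        (λ r → subst₂ C (sym (to-restriction a)) (sym (to-restriction b)) (proj₁ (aut (inj₁ a) (inj₁ b)) r)) ,
        (λ r → proj₂ (aut (inj₁ a) (inj₁ b)) (subst₂ C (to-restriction a) (to-restriction b) r))

    Determining-withPendants : ∀ {S} → Determining (MAdj t E) (root ∷ S) → Determining C (withPendants S)
    Determining-withPendants {S} det π aut fixes = fixes-all
      where
      open Inverse π
      open Automorphism π aut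
      ρ-fixes : ∀ a → a ∈ root ∷ S → Inverse.to restriction a ≡ a
      ρ-fixes _ (here refl) = inj₁-injective (trans (to-restriction root) IsAut-root)
      ρ-fixes a (there a∈S) =
        inj₁-injective (trans (to-restriction a) (fixes (inj₁ a) (∈-++⁺ˡ (∈-map⁺ inj₁ a∈S))))
      fixes-pendant : ∀ j → to (inj₂ (suc j)) ≡ inj₂ (suc j)
      fixes-pendant j = fixes _ (∈-++⁺ʳ (map inj₁ S) (∈-map⁺ inj₂ (∈-tabulate⁺ j)))
      fixes-all : ∀ x → to x ≡ x
      fixes-all (inj₁ a) =
        trans (sym (to-restriction a)) (cong inj₁ (det restriction restriction-IsAut ρ-fixes a))
      fixes-all (inj₂ (suc j)) = fixes-pendant j
      fixes-all (inj₂ zero) with IsAut-inj₂ zero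
      ... | zero  , eq = eq
      ... | suc j , eq =
        contradiction (inj₂-injective (Injection.injective (↔⇒↣ π) (trans eq (sym (fixes-pendant j))))) 0≢1+n

  extend : MV n t ↔ MV n t → Vertex ↔ Vertex
  extend σ = σ ⊎-↔ ↔-id (Fin (suc m))

  extend-IsAut : ∀ σ → IsAut (MAdj t E) σ → Inverse.to σ root ≡ root → IsAut C (extend σ)
  extend-IsAut σ aut σ-root = extend-aut
    where
    open Inverse σ
    inner↦non-root : ∀ {i s} → to (u i s) ≢ root
    inner↦non-root eq = contradiction (Injection.injective (↔⇒↣ σ) (trans eq (sym σ-root))) λ ()
    extend-aut : IsAut C (extend σ)
    extend-aut (inj₁ a)       (inj₁ b)       = aut a b
    extend-aut (inj₁ root)    (inj₂ _)       rewrite σ-root = (λ r → r) , (λ r → r)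
    extend-aut (inj₁ (u i s)) (inj₂ _)       with to (u i s) in eq
    ... | root  = contradiction eq inner↦non-root
    ... | u _ _ = (λ r → r) , (λ r → r)
    extend-aut (inj₂ _)       (inj₁ root)    rewrite σ-root = (λ r → r) , (λ r → r)
    extend-aut (inj₂ _)       (inj₁ (u i s)) with to (u i s) in eq
    ... | root  = contradiction eq inner↦non-root
    ... | u _ _ = (λ r → r) , (λ r → r)
    extend-aut (inj₂ _)       (inj₂ _)       = (λ r → r) , (λ r → r)

  swap : Fin (suc m) → Fin (suc m) → Vertex ↔ Vertex
  swap a b = ↔-id (MV n t) ⊎-↔ transpose a b

  swap-IsAut : ∀ a b → IsAut C (swap a b)
  swap-IsAut a b (inj₁ _)       (inj₁ _)       = (λ r → r) , (λ r → r)
  swap-IsAut a b (inj₁ root)    (inj₂ _)       = (λ r → r) , (λ r → r)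
  swap-IsAut a b (inj₁ (u _ _)) (inj₂ _)       = (λ r → r) , (λ r → r)
  swap-IsAut a b (inj₂ _)       (inj₁ root)    = (λ r → r) , (λ r → r)
  swap-IsAut a b (inj₂ _)       (inj₁ (u _ _)) = (λ r → r) , (λ r → r)
  swap-IsAut a b (inj₂ _)       (inj₂ _)       = (λ r → r) , (λ r → r)

  module _ {T : List Vertex} (det : Determining C T) where

    Determining-innerVertices : Determining (MAdj t E) (root ∷ innerVertices T)
    Determining-innerVertices σ aut fixes a =
      inj₁-injective (det (extend σ) (extend-IsAut σ aut σ-root) extend-fixes (inj₁ a))
      where
      σ-root : Inverse.to σ root ≡ root
      σ-root = fixes root (here refl)
      extend-fixes : ∀ x → x ∈ T → Inverse.to (extend σ) x ≡ x
      extend-fixes (inj₁ root)    _   = cong inj₁ σ-root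
      extend-fixes (inj₁ (u i s)) x∈T =
        cong inj₁ (fixes (u i s) (there (∈-filter⁺ nonRoot? (∈-lefts⁺ x∈T) λ ())))
      extend-fixes (inj₂ _)       _   = refl

    Determining⇒missing-pendant-unique : ∀ {a b} → inj₂ a ∉ T → inj₂ b ∉ T → a ≡ b
    Determining⇒missing-pendant-unique {a} {b} a∉T b∉T =
      trans (sym (inj₂-injective (det (swap a b) (swap-IsAut a b) swap-fixes (inj₂ a)))) (transpose-matchˡ a b)
      where
      swap-fixes : ∀ x → x ∈ T → Inverse.to (swap a b) x ≡ x
      swap-fixes (inj₁ _) _   = refl
      swap-fixes (inj₂ c) c∈T = cong inj₂ (transpose-other (λ { refl → a∉T c∈T }) (λ { refl → b∉T c∈T }))

  withPendants-Unique : ∀ {S} → Unique S → Unique (withPendants S)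
  withPendants-Unique S! =
    map-inj₁-++-map-inj₂-Unique S! (Unique.drop⁺ 1 (Unique.allFin⁺ (suc m)))

  length-withPendants : ∀ S → length (withPendants S) ≡ length S + m
  length-withPendants S = begin
    length (withPendants S)                           ≡⟨ length-++ (map inj₁ S) ⟩
    length (map inj₁ S) + length (map inj₂ pendants)  ≡⟨ cong₂ _+_ (length-map inj₁ S) (length-map inj₂ pendants) ⟩
    length S + length pendants                        ≡⟨ cong (length S +_) (length-tabulate suc) ⟩
    length S + m                                      ∎
    where
    open ≡-Reasoning
    pendants : List (Fin (suc m))
    pendants = drop 1 (allFin (suc m))

  withPendants-minimal : ∀ {S} → IsMinRootDet t E S →
                         ∀ T → Unique T → Determining C T → length (withPendants S) ≤ length T
  withPendants-minimal {S} (_ , _ , _ , S-minimal) T T! det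
    with allButOne-witnesses (λ k → inj₂ k ∈? T) (Determining⇒missing-pendant-unique det)
  ... | ks , ks! , ks⊆T , m≤ks = begin
    length (withPendants S)   ≡⟨ length-withPendants S ⟩
    length S + m              ≤⟨ +-mono-≤ (S-minimal inner inner! root∉inner (Determining-innerVertices det)) m≤ks ⟩
    length inner + length ks  ≤⟨ Unique-⊎-⊆⇒length≤ _≟_ inner! ks! inner⊆T pendants⊆T ⟩
    length T                  ∎
    where
    open ≤-Reasoning
    inner : List (MV n t)
    inner = innerVertices T
    inner! : Unique inner
    inner! = Unique.filter⁺ nonRoot? (lefts-Unique T!)
    root∉inner : root ∉ inner
    root∉inner root∈ = proj₂ (∈-filter⁻ nonRoot? {xs = lefts T} root∈) refl
    inner⊆T : map inj₁ inner ⊆ T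
    inner⊆T p with ∈-map⁻ inj₁ p
    ... | a , a∈ , refl = ∈-lefts⁻ T (proj₁ (∈-filter⁻ nonRoot? {xs = lefts T} a∈))
    pendants⊆T : map inj₂ ks ⊆ T
    pendants⊆T p with ∈-map⁻ inj₂ p
    ... | k , k∈ , refl = ks⊆T k∈

lemma3p4 : (n t ℓ : ℕ) (E : Rel (Fin n)) → IsSimple E → HasEdge E → NoIsolated E →
    1 ≤ t → 1 ≤ ℓ → (S : List (MV n t)) → IsMinRootDet t E S →
    IsMinDet (CAdj t ℓ E) (map inj₁ S ++ map inj₂ (drop 1 (allFin ℓ)))
lemma3p4 n t (suc m) E simple hasEdge noIsolated _ (s≤s z≤n) S S-min@(S! , _ , S-det , _) =
  withPendants-Unique S! ,
  Determining-withPendants (MAdj-TwoNeighbours noIsolated simple hasEdge) S-det ,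
  withPendants-minimal S-min
  where open PendantExtension {n} {t} {m} E
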